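{- For every integer $m\geq 1$, the graph $[m\Gamma(\mathbb{Z}_9)+\Gamma(\mathbb{Z}_4)]\times\Gamma(\mathbb{Z}_9)$ admits a distance antimagic labeling, where $m\Gamma(\mathbb{Z}_9)+\Gamma(\mathbb{Z}_4)$ is the join of $m\Gamma(\mathbb{Z}_9)$ and $\Gamma(\mathbb{Z}_4)$ and $\times$ is the Cartesian product.
   Context: For an integer $n \geq 2$, the zero-divisor graph $\Gamma(\mathbb{Z}_n)$ is the simple graph whose vertex set is the set of nonzero zero-divisors of the ring $\mathbb{Z}_n$, two distinct vertices $u,v$ being adjacent iff $uv \equiv 0 \pmod n$. For a graph $H$ and positive integer $k$, $kH$ denotes the disjoint union of $k$ copies of $H$. For graphs $G,H$, the join $G+H$ is the graph obtained from the disjoint union of $G$ and $H$ by adding every edge between a vertex of $G$ and a vertex of $H$. The Cartesian product $G\times H$ has vertex set $V(G)\times V(H)$, with $(u,v)$ adjacent to $(u',v')$ iff either $u=u'$ and $vv'\in E(H)$, or $v=v'$ and $uu'\in E(G)$. A distance antimagic labeling (DAML) of a graph $G$ with $N$ vertices is a bijection $f:V(G)\to\{1,\dots,N\}$ such that the weights $w(v)=\sum_{u\in N(v)} f(u)$, where $N(v)$ is the open neighbourhood of $v$, are pairwise distinct over all vertices $v$. A graph admits DAML if such a labeling exists. -}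

module Defs where

open import Data.Bool using (Bool; true; false; if_then_else_; _∧_; _∨_; not)
open import Data.Nat using (ℕ; zero; suc; _+_; _*_; _%_; _≡ᵇ_)
open import Data.Fin using (Fin; toℕ; splitAt; remQuot)
open import Data.Fin.Properties using (_≟_)
open import Data.Sum using (inj₁; inj₂)
open import Data.Product using (_×_; _,_; ∃)
open import Data.List using (List; []; _∷_; length; filterᵇ; map; allFin; lookup)
open import Data.Bool.ListAction using (any)
open import Data.Nat.ListAction using (sum)
open import Relation.Nullary using (does)
open import Relation.Binary.PropositionalEquality using (_≡_)
open import Function.Definitions using (Bijective)
open import Function using (_∘_)

-- A finite simple graph on vertex set Fin size, given by a Boolean adjacency
-- relation (the constructions below produce symmetric, irreflexive relations).
record Graph : Set where
  field
    size : ℕ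
    adj  : Fin size → Fin size → Bool
open Graph public

nonzeroResidues : ℕ → List ℕ
nonzeroResidues zero    = []
nonzeroResidues (suc n) = Data.List.drop 1 (map toℕ (allFin (suc n)))
  where import Data.List

mulZero : ℕ → ℕ → ℕ → Bool
mulZero zero    a b = (a * b) ≡ᵇ 0
mulZero (suc n) a b = ((a * b) % suc n) ≡ᵇ 0

isZeroDivisor : ℕ → ℕ → Bool
isZeroDivisor n a = any (mulZero n a) (nonzeroResidues n)

zeroDivisors : ℕ → List ℕ
zeroDivisors n = filterᵇ (isZeroDivisor n) (nonzeroResidues n)

distinctAnd : ∀ {k} → Fin k → Fin k → Bool → Bool
distinctAnd u v b = not (does (u ≟ v)) ∧ b

Γℤ : ℕ → Graph
Γℤ n = record
  { size = length (zeroDivisors n)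
  ; adj  = λ u v → distinctAnd u v
             (mulZero n (lookup (zeroDivisors n) u) (lookup (zeroDivisors n) v))
  }

_⊕_ : Graph → Graph → Graph
G ⊕ H = record
  { size = size G + size H
  ; adj  = λ u v → adjU (splitAt (size G) u) (splitAt (size G) v)
  }
  where
  adjU : _ → _ → Bool
  adjU (inj₁ x) (inj₁ y) = adj G x y
  adjU (inj₂ x) (inj₂ y) = adj H x y
  adjU _        _        = false

emptyGraph : Graph
emptyGraph = record { size = 0 ; adj = λ () }

copies : ℕ → Graph → Graph
copies zero    H = emptyGraph
copies (suc k) H = H ⊕ copies k H

_⊹_ : Graph → Graph → Graph
G ⊹ H = record
  { size = size G + size H
  ; adj  = λ u v → adjJ (splitAt (size G) u) (splitAt (size G) v)
  }
  where
  adjJ : _ → _ → Bool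
  adjJ (inj₁ x) (inj₁ y) = adj G x y
  adjJ (inj₂ x) (inj₂ y) = adj H x y
  adjJ _        _        = true

_□_ : Graph → Graph → Graph
G □ H = record
  { size = size G * size H
  ; adj  = λ p q → adjC (remQuot (size H) p) (remQuot (size H) q)
  }
  where
  adjC : Fin (size G) × Fin (size H) → Fin (size G) × Fin (size H) → Bool
  adjC (u , v) (u' , v') =
    (does (u ≟ u') ∧ adj H v v') ∨ (does (v ≟ v') ∧ adj G u u')

-- weight of v under labeling f (labels are toℕ (f u) + 1 ∈ {1,…,N})
weight : (G : Graph) → (Fin (size G) → Fin (size G)) → Fin (size G) → ℕ
weight G f v =
  sum (map (λ u → if adj G v u then suc (toℕ (f u)) else 0) (allFin (size G)))

IsDAML : (G : Graph) → (Fin (size G) → Fin (size G)) → Set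
IsDAML G f = ∀ u v → weight G f u ≡ weight G f v → u ≡ v

HasDAML : Graph → Set
HasDAML G = ∃ λ (f : Fin (size G) → Fin (size G)) → Bijective _≡_ _≡_ f × IsDAML G f

-- Γ(ℤ₉) is K₂ (on 3, 6) and Γ(ℤ₄) is K₁ (on 2), so the graph is the prism over the friendship
-- graph mK₂ + K₁: m blades, each an edge joined to a hub. Number the vertices of the friendship graph
-- 0, …, 2m with the hub last, and give the two copies of vertex t the labels 2t + 1 and 2t + 2, the
-- smaller one in the second layer exactly when t is even. A vertex of blade d sees its blade partner,
-- the hub and its own copy, so its weight is 4m + 5 + 8d + r with a different r ∈ {0, …, 3} for each of
-- the four prism vertices of the blade. A hub vertex sees every blade vertex of its layer, and these
-- labels sum to m(4m + 1); its weight m(4m + 1) + 4m + 1 + y exceeds every blade weight (at most 12m)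
-- once m ≥ 2. For m = 1 the prism is K₃ × K₂, where no labelling of this layered kind is antimagic, but
-- exchanging the labels 4 and 6 of the identity labelling gives one, which is checked by computation.
module Submission where

open import Data.Bool using (Bool; true; false; if_then_else_; _∧_; _∨_)
open import Data.Bool.Properties using (∨-identityʳ)
open import Data.Fin using (Fin; #_; zero; suc; toℕ; _↑ˡ_; _↑ʳ_; splitAt; combine; remQuot; opposite; inject₁; fromℕ)
open import Data.Fin.Permutation using (Permutation′; permutation; _⟨$⟩ʳ_; transpose)
open import Data.Fin.Properties
  using (_≟_; all?; splitAt-↑ˡ; splitAt-↑ʳ; splitAt⁻¹-↑ˡ; splitAt⁻¹-↑ʳ; remQuot-combine; combine-remQuot;
         toℕ-combine; toℕ-↑ˡ; toℕ-↑ʳ; toℕ<n; toℕ-inject₁; toℕ-fromℕ; toℕ-injective; opposite-involutive)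
import Data.List as List
open import Data.Nat as ℕ
  using (ℕ; zero; suc; _+_; _*_; _%_; _≤_; _<_; _≥_; z≤n; s≤s; z<s; NonZero; parity)
open import Data.Nat.DivMod using (m<n⇒m%n≡m; [m+kn]%n≡m%n)
open import Data.Nat.ListAction using () renaming (sum to listSum)
open import Data.Nat.Properties
  using (+-0-commutativeMonoid; +-assoc; +-comm; +-identityʳ; +-cancelˡ-≡; *-cancelʳ-≡; suc-injective;
         ≤-refl; ≤-trans; m≤m+n; m<m+n; +-monoˡ-≤; +-monoʳ-≤; *-monoˡ-≤; *-monoʳ-≤; <⇒≢; module ≤-Reasoning)
open import Data.Nat.Tactic.RingSolver using (solve-∀)
open import Data.Parity.Base using (Parity; 0ℙ; 1ℙ)
open import Data.Product using (_×_; _,_; proj₁; proj₂; uncurry)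
open import Data.Sum using (inj₁; inj₂)
open import Function using (_∘_)
open import Function.Bundles using (Bijection)
open import Function.Definitions using (StrictlySurjective; Injective)
open import Function.Properties.Inverse using (↔⇒⤖)
open import Relation.Binary.PropositionalEquality
open import Relation.Nullary using (Dec; does; yes; no; contradiction)
open import Relation.Nullary.Decidable using (_→-dec_; from-yes)
open import Algebra.Properties.CommutativeMonoid.Sum +-0-commutativeMonoid
  using (sum-syntax; sum-cong-≗; sum-replicate-zero; ∑-distrib-+; sum-init-last)

open import Defs

∑-↑ : ∀ m n (g : Fin (m + n) → ℕ) →
      ∑[ i < m + n ] g i ≡ ∑[ i < m ] g (i ↑ˡ n) + ∑[ j < n ] g (m ↑ʳ j)
∑-↑ zero    n g = refl
∑-↑ (suc m) n g = trans (cong (g zero +_) (∑-↑ m n (g ∘ suc))) (sym (+-assoc (g zero) _ _))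

∑-combine : ∀ m k (g : Fin (m * k) → ℕ) →
            ∑[ p < m * k ] g p ≡ ∑[ i < m ] ∑[ j < k ] g (combine i j)
∑-combine zero    k g = refl
∑-combine (suc m) k g =
  trans (∑-↑ k (m * k) g) (cong (∑[ j < k ] g (j ↑ˡ m * k) +_) (∑-combine m k (g ∘ (k ↑ʳ_))))

∑-δ : ∀ {n} (x : Fin n) (g : Fin n → ℕ) → ∑[ u < n ] (if does (x ≟ u) then g u else 0) ≡ g x
∑-δ {suc n} zero    g = trans (cong (g zero +_) (sum-replicate-zero n)) (+-identityʳ (g zero))
∑-δ {suc n} (suc x) g = ∑-δ x (g ∘ suc)

∑-if : ∀ n b (g : Fin n → ℕ) → ∑[ i < n ] (if b then g i else 0) ≡ (if b then ∑[ i < n ] g i else 0)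
∑-if n true  g = refl
∑-if n false g = sum-replicate-zero n

sum-map-tabulate : ∀ {A : Set} n (g : Fin n → A) (h : A → ℕ) →
                   listSum (List.map h (List.tabulate g)) ≡ ∑[ i < n ] h (g i)
sum-map-tabulate zero    g h = refl
sum-map-tabulate (suc n) g h = cong (h (g zero) +_) (sum-map-tabulate n (g ∘ suc) h)

Loopless : Graph → Set
Loopless G = ∀ v → adj G v v ≡ false

neighbourSum : (G : Graph) → (Fin (size G) → ℕ) → Fin (size G) → ℕ
neighbourSum G ℓ v = ∑[ u < size G ] (if adj G v u then ℓ u else 0)

label : ∀ {n} → (Fin n → Fin n) → Fin n → ℕ
label f v = suc (toℕ (f v))

weight≡neighbourSum : ∀ G f v → weight G f v ≡ neighbourSum G (label f) v
weight≡neighbourSum G f v = sum-map-tabulate (size G) (λ u → u) _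

module _ (G H : Graph) where

  adj-□ : ∀ x y u v → adj (G □ H) (combine x y) (combine u v) ≡
                       (does (x ≟ u) ∧ adj H y v) ∨ (does (y ≟ v) ∧ adj G x u)
  adj-□ x y u v = cong₂ adjC (remQuot-combine x y) (remQuot-combine u v)
    where
    adjC : Fin (size G) × Fin (size H) → Fin (size G) × Fin (size H) → Bool
    adjC (x , y) (u , v) = (does (x ≟ u) ∧ adj H y v) ∨ (does (y ≟ v) ∧ adj G x u)

  □-indicator : Loopless H → ∀ x y u v (t : ℕ) →
    (if adj (G □ H) (combine x y) (combine u v) then t else 0) ≡
    (if does (y ≟ v) then (if adj G x u then t else 0) else 0) +
    (if does (x ≟ u) then (if adj H y v then t else 0) else 0)
  □-indicator loopless x y u v t rewrite adj-□ x y u v with x ≟ u | y ≟ v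
  ... | yes refl | yes refl rewrite loopless y = sym (+-identityʳ _)
  ... | yes refl | no _     = cong (λ b → if b then t else 0) (∨-identityʳ (adj H y v))
  ... | no _     | yes refl = sym (+-identityʳ _)
  ... | no _     | no _     = refl

  neighbourSum-□ : Loopless H → ∀ ℓ x y →
    neighbourSum (G □ H) ℓ (combine x y) ≡
    neighbourSum G (λ u → ℓ (combine u y)) x + neighbourSum H (λ v → ℓ (combine x v)) y
  neighbourSum-□ loopless ℓ x y = begin
    neighbourSum (G □ H) ℓ (combine x y)
      ≡⟨ ∑-combine (size G) (size H) _ ⟩
    ∑[ u < size G ] ∑[ v < size H ] (if adj (G □ H) (combine x y) (combine u v) then ℓ (combine u v) else 0)
      ≡⟨ sum-cong-≗ (λ u → trans (sum-cong-≗ (λ v → □-indicator loopless x y u v _))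
                                  (∑-distrib-+ (inLayer u) (inFibre u))) ⟩
    ∑[ u < size G ] (∑[ v < size H ] inLayer u v + ∑[ v < size H ] inFibre u v)
      ≡⟨ ∑-distrib-+ (λ u → ∑[ v < size H ] inLayer u v) (λ u → ∑[ v < size H ] inFibre u v) ⟩
    ∑[ u < size G ] ∑[ v < size H ] inLayer u v + ∑[ u < size G ] ∑[ v < size H ] inFibre u v
      ≡⟨ cong₂ _+_ (sum-cong-≗ (λ u → ∑-δ y (λ v → if adj G x u then ℓ (combine u v) else 0)))
                   (trans (sum-cong-≗ (λ u → ∑-if (size H) (does (x ≟ u))
                                                     (λ v → if adj H y v then ℓ (combine u v) else 0)))
                          (∑-δ x (λ u → ∑[ v < size H ] (if adj H y v then ℓ (combine u v) else 0)))) ⟩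
    neighbourSum G (λ u → ℓ (combine u y)) x + neighbourSum H (λ v → ℓ (combine x v)) y ∎
    where
    open ≡-Reasoning
    inLayer inFibre : Fin (size G) → Fin (size H) → ℕ
    inLayer u v = if does (y ≟ v) then (if adj G x u then ℓ (combine u v) else 0) else 0
    inFibre u v = if does (x ≟ u) then (if adj H y v then ℓ (combine u v) else 0) else 0

  neighbourSum-⊹ˡ : ∀ ℓ x → neighbourSum (G ⊹ H) ℓ (x ↑ˡ size H) ≡
                    neighbourSum G (ℓ ∘ (_↑ˡ size H)) x + ∑[ j < size H ] ℓ (size G ↑ʳ j)
  neighbourSum-⊹ˡ ℓ x = trans (∑-↑ (size G) (size H) _) (cong₂ _+_ (sum-cong-≗ inG) (sum-cong-≗ inH))
    where
    inG : ∀ i → (if adj (G ⊹ H) (x ↑ˡ size H) (i ↑ˡ size H) then ℓ (i ↑ˡ size H) else 0) ≡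
                (if adj G x i then ℓ (i ↑ˡ size H) else 0)
    inG i rewrite splitAt-↑ˡ (size G) x (size H) | splitAt-↑ˡ (size G) i (size H) = refl
    inH : ∀ j → (if adj (G ⊹ H) (x ↑ˡ size H) (size G ↑ʳ j) then ℓ (size G ↑ʳ j) else 0) ≡ ℓ (size G ↑ʳ j)
    inH j rewrite splitAt-↑ˡ (size G) x (size H) | splitAt-↑ʳ (size G) (size H) j = refl

  neighbourSum-⊹ʳ : ∀ ℓ y → neighbourSum (G ⊹ H) ℓ (size G ↑ʳ y) ≡
                    ∑[ i < size G ] ℓ (i ↑ˡ size H) + neighbourSum H (ℓ ∘ (size G ↑ʳ_)) y
  neighbourSum-⊹ʳ ℓ y = trans (∑-↑ (size G) (size H) _) (cong₂ _+_ (sum-cong-≗ inG) (sum-cong-≗ inH))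
    where
    inG : ∀ i → (if adj (G ⊹ H) (size G ↑ʳ y) (i ↑ˡ size H) then ℓ (i ↑ˡ size H) else 0) ≡ ℓ (i ↑ˡ size H)
    inG i rewrite splitAt-↑ʳ (size G) (size H) y | splitAt-↑ˡ (size G) i (size H) = refl
    inH : ∀ j → (if adj (G ⊹ H) (size G ↑ʳ y) (size G ↑ʳ j) then ℓ (size G ↑ʳ j) else 0) ≡
                (if adj H y j then ℓ (size G ↑ʳ j) else 0)
    inH j rewrite splitAt-↑ʳ (size G) (size H) y | splitAt-↑ʳ (size G) (size H) j = refl

  neighbourSum-⊕ˡ : ∀ ℓ x → neighbourSum (G ⊕ H) ℓ (x ↑ˡ size H) ≡ neighbourSum G (ℓ ∘ (_↑ˡ size H)) x
  neighbourSum-⊕ˡ ℓ x =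
    trans (∑-↑ (size G) (size H) _)
      (trans (cong₂ _+_ (sum-cong-≗ inG) (trans (sum-cong-≗ inH) (sum-replicate-zero (size H)))) (+-identityʳ _))
    where
    inG : ∀ i → (if adj (G ⊕ H) (x ↑ˡ size H) (i ↑ˡ size H) then ℓ (i ↑ˡ size H) else 0) ≡
                (if adj G x i then ℓ (i ↑ˡ size H) else 0)
    inG i rewrite splitAt-↑ˡ (size G) x (size H) | splitAt-↑ˡ (size G) i (size H) = refl
    inH : ∀ j → (if adj (G ⊕ H) (x ↑ˡ size H) (size G ↑ʳ j) then ℓ (size G ↑ʳ j) else 0) ≡ 0
    inH j rewrite splitAt-↑ˡ (size G) x (size H) | splitAt-↑ʳ (size G) (size H) j = refl

  neighbourSum-⊕ʳ : ∀ ℓ y → neighbourSum (G ⊕ H) ℓ (size G ↑ʳ y) ≡ neighbourSum H (ℓ ∘ (size G ↑ʳ_)) y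
  neighbourSum-⊕ʳ ℓ y =
    trans (∑-↑ (size G) (size H) _)
      (cong₂ _+_ (trans (sum-cong-≗ inG) (sum-replicate-zero (size G))) (sum-cong-≗ inH))
    where
    inG : ∀ i → (if adj (G ⊕ H) (size G ↑ʳ y) (i ↑ˡ size H) then ℓ (i ↑ˡ size H) else 0) ≡ 0
    inG i rewrite splitAt-↑ʳ (size G) (size H) y | splitAt-↑ˡ (size G) i (size H) = refl
    inH : ∀ j → (if adj (G ⊕ H) (size G ↑ʳ y) (size G ↑ʳ j) then ℓ (size G ↑ʳ j) else 0) ≡
                (if adj H y j then ℓ (size G ↑ʳ j) else 0)
    inH j rewrite splitAt-↑ʳ (size G) (size H) y | splitAt-↑ʳ (size G) (size H) j = refl

inCopy : ∀ {m} {H : Graph} → Fin m → Fin (size H) → Fin (size (copies m H))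
inCopy {suc m} {H} zero    e = e ↑ˡ size (copies m H)
inCopy {suc m} {H} (suc d) e = size H ↑ʳ inCopy d e

module _ (H : Graph) where

  neighbourSum-copies : ∀ {m} ℓ (d : Fin m) e →
                        neighbourSum (copies m H) ℓ (inCopy d e) ≡ neighbourSum H (ℓ ∘ inCopy d) e
  neighbourSum-copies {suc m} ℓ zero    e = neighbourSum-⊕ˡ H (copies m H) ℓ e
  neighbourSum-copies {suc m} ℓ (suc d) e =
    trans (neighbourSum-⊕ʳ H (copies m H) ℓ (inCopy d e)) (neighbourSum-copies (ℓ ∘ (size H ↑ʳ_)) d e)

  ∑-copies : ∀ m (g : Fin (size (copies m H)) → ℕ) →
             ∑[ w < size (copies m H) ] g w ≡ ∑[ d < m ] ∑[ e < size H ] g (inCopy d e)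
  ∑-copies zero    g = refl
  ∑-copies (suc m) g =
    trans (∑-↑ (size H) _ g)
      (cong (∑[ e < size H ] g (e ↑ˡ size (copies m H)) +_) (∑-copies m (g ∘ (size H ↑ʳ_))))

  size-copies : ∀ m → size (copies m H) ≡ m * size H
  size-copies zero    = refl
  size-copies (suc m) = cong (size H +_) (size-copies m)

  toℕ-inCopy : ∀ {m} (d : Fin m) e → toℕ (inCopy {m} {H} d e) ≡ toℕ d * size H + toℕ e
  toℕ-inCopy {suc m} zero    e = toℕ-↑ˡ e _
  toℕ-inCopy {suc m} (suc d) e =
    trans (toℕ-↑ʳ (size H) (inCopy d e)) (trans (cong (size H +_) (toℕ-inCopy d e)) (sym (+-assoc (size H) _ _)))

  inCopy-surjective : ∀ m → StrictlySurjective _≡_ (uncurry (inCopy {m} {H}))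
  inCopy-surjective (suc m) w with splitAt (size H) w in eq
  ... | inj₁ e = (zero , e) , splitAt⁻¹-↑ˡ eq
  ... | inj₂ w′ with inCopy-surjective m w′
  ...   | (d , e) , refl = (suc d , e) , splitAt⁻¹-↑ʳ eq

Windmill : ℕ → Graph
Windmill m = copies m (Γℤ 9) ⊹ Γℤ 4

Prism : ℕ → Graph
Prism m = Windmill m □ Γℤ 9

data WindmillVertex (m : ℕ) : Set where
  hub   : WindmillVertex m
  blade : Fin m → Fin 2 → WindmillVertex m

⟦_⟧ : ∀ {m} → WindmillVertex m → Fin (size (Windmill m))
⟦_⟧ {m} hub = size (copies m (Γℤ 9)) ↑ʳ zero
⟦ blade d e ⟧ = inCopy d e ↑ˡ 1

⟦⟧-surjective : ∀ m → StrictlySurjective _≡_ (⟦_⟧ {m})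
⟦⟧-surjective m x with splitAt (size (copies m (Γℤ 9))) x in eq
... | inj₂ zero = hub , splitAt⁻¹-↑ʳ eq
... | inj₁ w with inCopy-surjective (Γℤ 9) m w
...   | (d , e) , refl = blade d e , splitAt⁻¹-↑ˡ eq

prismVertex : ∀ {m} → WindmillVertex m × Fin 2 → Fin (size (Prism m))
prismVertex (v , y) = combine ⟦ v ⟧ y

prismVertex-surjective : ∀ m → StrictlySurjective _≡_ (prismVertex {m})
prismVertex-surjective m p with ⟦⟧-surjective m (proj₁ (remQuot {size (Windmill m)} 2 p))
... | v , ⟦v⟧≡x = (v , proj₂ (remQuot {size (Windmill m)} 2 p)) ,
                  trans (cong (λ x → combine x _) ⟦v⟧≡x) (combine-remQuot {size (Windmill m)} 2 p)

Γℤ9-loopless : Loopless (Γℤ 9)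
Γℤ9-loopless zero       = refl
Γℤ9-loopless (suc zero) = refl

neighbourSum-Γℤ9 : ∀ ℓ y → neighbourSum (Γℤ 9) ℓ y ≡ ℓ (opposite y)
neighbourSum-Γℤ9 ℓ zero       = +-identityʳ _
neighbourSum-Γℤ9 ℓ (suc zero) = +-identityʳ _

neighbourSum-hub : ∀ m ℓ y → neighbourSum (Prism m) ℓ (combine ⟦ hub {m} ⟧ y) ≡
                   ∑[ d < m ] ∑[ e < 2 ] ℓ (combine ⟦ blade d e ⟧ y) + ℓ (combine ⟦ hub {m} ⟧ (opposite y))
neighbourSum-hub m ℓ y =
  trans (neighbourSum-□ (Windmill m) (Γℤ 9) Γℤ9-loopless ℓ ⟦ hub {m} ⟧ y)
    (cong₂ _+_ (trans (neighbourSum-⊹ʳ (copies m (Γℤ 9)) (Γℤ 4) _ zero)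
                      (trans (+-identityʳ _) (∑-copies (Γℤ 9) m _)))
               (neighbourSum-Γℤ9 (λ v → ℓ (combine ⟦ hub {m} ⟧ v)) y))

neighbourSum-blade : ∀ m ℓ (d : Fin m) e y → neighbourSum (Prism m) ℓ (combine ⟦ blade d e ⟧ y) ≡
                     ℓ (combine ⟦ blade d (opposite e) ⟧ y) + ℓ (combine ⟦ hub {m} ⟧ y) +
                     ℓ (combine ⟦ blade d e ⟧ (opposite y))
neighbourSum-blade m ℓ d e y =
  trans (neighbourSum-□ (Windmill m) (Γℤ 9) Γℤ9-loopless ℓ ⟦ blade d e ⟧ y)
    (cong₂ _+_ (trans (neighbourSum-⊹ˡ (copies m (Γℤ 9)) (Γℤ 4) _ (inCopy d e))
                      (cong₂ _+_ (trans (neighbourSum-copies (Γℤ 9) _ d e)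
                                        (neighbourSum-Γℤ9 (λ e′ → ℓ (combine ⟦ blade d e′ ⟧ y)) e))
                                 (+-identityʳ _)))
               (neighbourSum-Γℤ9 (λ v → ℓ (combine ⟦ blade d e ⟧ v)) y))

layerSwap : Parity → Fin 2 → Fin 2
layerSwap 0ℙ = opposite
layerSwap 1ℙ y = y

layerSwap-involutive : ∀ q y → layerSwap q (layerSwap q y) ≡ y
layerSwap-involutive 0ℙ = opposite-involutive
layerSwap-involutive 1ℙ y = refl

swapEvenLayers : ∀ n → Fin (n * 2) → Fin (n * 2)
swapEvenLayers n = uncurry (λ x y → combine x (layerSwap (parity (toℕ x)) y)) ∘ remQuot {n} 2

swapEvenLayers-combine : ∀ {n} (x : Fin n) y →
                         swapEvenLayers n (combine x y) ≡ combine x (layerSwap (parity (toℕ x)) y)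
swapEvenLayers-combine x y = cong (uncurry (λ x y → combine x (layerSwap (parity (toℕ x)) y))) (remQuot-combine x y)

swapEvenLayers-involutive : ∀ n p → swapEvenLayers n (swapEvenLayers n p) ≡ p
swapEvenLayers-involutive n p =
  subst (λ q → swapEvenLayers n (swapEvenLayers n q) ≡ q) (combine-remQuot {n} 2 p)
        (involutive-combine (proj₁ (remQuot {n} 2 p)) (proj₂ (remQuot {n} 2 p)))
  where
  involutive-combine : ∀ x y → swapEvenLayers n (swapEvenLayers n (combine x y)) ≡ combine x y
  involutive-combine x y =
    trans (cong (swapEvenLayers n) (swapEvenLayers-combine x y))
      (trans (swapEvenLayers-combine x _) (cong (combine x) (layerSwap-involutive (parity (toℕ x)) y)))

swapEvenLayers-permutation : ∀ n → Permutation′ (n * 2)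
swapEvenLayers-permutation n =
  permutation (swapEvenLayers n) (swapEvenLayers n) (swapEvenLayers-involutive n) (swapEvenLayers-involutive n)

prismLabel : ℕ → Fin 2 → ℕ
prismLabel t y = suc (2 * t + toℕ (layerSwap (parity t) y))

label-swapEvenLayers : ∀ {n} (x : Fin n) y → label (swapEvenLayers n) (combine x y) ≡ prismLabel (toℕ x) y
label-swapEvenLayers x y = trans (cong (suc ∘ toℕ) (swapEvenLayers-combine x y)) (cong suc (toℕ-combine x _))

parity-*2+ : ∀ k t → parity (k * 2 + t) ≡ parity t
parity-*2+ zero    t = refl
parity-*2+ (suc k) t = parity-*2+ k t

prismLabel-*2+ : ∀ k t y → prismLabel (k * 2 + t) y ≡ k * 4 + prismLabel t y
prismLabel-*2+ k t y rewrite parity-*2+ k t = shift k t (toℕ (layerSwap (parity t) y))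
  where
  shift : ∀ k t z → suc (2 * (k * 2 + t) + z) ≡ k * 4 + suc (2 * t + z)
  shift = solve-∀

vertexLabel : ∀ {m} → WindmillVertex m → Fin 2 → ℕ
vertexLabel {m} hub y = m * 4 + prismLabel 0 y
vertexLabel (blade d e) y = toℕ d * 4 + prismLabel (toℕ e) y

label-⟦⟧ : ∀ m (v : WindmillVertex m) y →
           label (swapEvenLayers (size (Windmill m))) (combine ⟦ v ⟧ y) ≡ vertexLabel v y
label-⟦⟧ m hub y =
  trans (label-swapEvenLayers ⟦ hub {m} ⟧ y)
    (trans (cong (λ t → prismLabel t y) (trans (toℕ-↑ʳ _ zero) (cong (_+ 0) (size-copies (Γℤ 9) m))))
           (prismLabel-*2+ m 0 y))
label-⟦⟧ m (blade d e) y =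
  trans (label-swapEvenLayers ⟦ blade d e ⟧ y)
    (trans (cong (λ t → prismLabel t y) (trans (toℕ-↑ˡ _ 1) (toℕ-inCopy (Γℤ 9) d e)))
           (prismLabel-*2+ (toℕ d) (toℕ e) y))

∑-8i+5 : ∀ n → ∑[ i < n ] (toℕ i * 8 + 5) ≡ n * (n * 4 + 1)
∑-8i+5 zero    = refl
∑-8i+5 (suc n) = begin
  ∑[ i < suc n ] (toℕ i * 8 + 5)
    ≡⟨ sum-init-last {n} (λ i → toℕ i * 8 + 5) ⟩
  ∑[ i < n ] (toℕ (inject₁ i) * 8 + 5) + (toℕ (fromℕ n) * 8 + 5)
    ≡⟨ cong₂ _+_ (sum-cong-≗ {n} (λ i → cong (λ t → t * 8 + 5) (toℕ-inject₁ i)))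
                 (cong (λ t → t * 8 + 5) (toℕ-fromℕ n)) ⟩
  ∑[ i < n ] (toℕ i * 8 + 5) + (n * 8 + 5)
    ≡⟨ cong (_+ (n * 8 + 5)) (∑-8i+5 n) ⟩
  n * (n * 4 + 1) + (n * 8 + 5)
    ≡⟨ step n ⟩
  suc n * (suc n * 4 + 1) ∎
  where
  open ≡-Reasoning
  step : ∀ n → n * (n * 4 + 1) + (n * 8 + 5) ≡ suc n * (suc n * 4 + 1)
  step = solve-∀

bladeOffset : Fin 2 → Fin 2 → ℕ
bladeOffset zero       zero       = 1
bladeOffset zero       (suc zero) = 2
bladeOffset (suc zero) zero       = 3
bladeOffset (suc zero) (suc zero) = 0

bladeOffset≤3 : ∀ e y → bladeOffset e y ≤ 3
bladeOffset≤3 zero       zero       = s≤s z≤n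
bladeOffset≤3 zero       (suc zero) = s≤s (s≤s z≤n)
bladeOffset≤3 (suc zero) zero       = ≤-refl
bladeOffset≤3 (suc zero) (suc zero) = z≤n

bladeOffset<8 : ∀ e y → bladeOffset e y < 8
bladeOffset<8 e y = s≤s (≤-trans (bladeOffset≤3 e y) (m≤m+n 3 4))

bladeOffset⁻¹ : ℕ → Fin 2 × Fin 2
bladeOffset⁻¹ 0 = suc zero , suc zero
bladeOffset⁻¹ 1 = zero , zero
bladeOffset⁻¹ 2 = zero , suc zero
bladeOffset⁻¹ _ = suc zero , zero

bladeOffset⁻¹-bladeOffset : ∀ e y → bladeOffset⁻¹ (bladeOffset e y) ≡ (e , y)
bladeOffset⁻¹-bladeOffset zero       zero       = refl
bladeOffset⁻¹-bladeOffset zero       (suc zero) = refl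
bladeOffset⁻¹-bladeOffset (suc zero) zero       = refl
bladeOffset⁻¹-bladeOffset (suc zero) (suc zero) = refl

bladeOffset-injective : ∀ {e y e′ y′} → bladeOffset e y ≡ bladeOffset e′ y′ → (e , y) ≡ (e′ , y′)
bladeOffset-injective {e} {y} {e′} {y′} eq =
  trans (sym (bladeOffset⁻¹-bladeOffset e y)) (trans (cong bladeOffset⁻¹ eq) (bladeOffset⁻¹-bladeOffset e′ y′))

hubWeight : ℕ → Fin 2 → ℕ
hubWeight m y = m * (m * 4 + 1) + m * 4 + suc (toℕ y)

bladeWeight : ∀ {m} → Fin m → Fin 2 → Fin 2 → ℕ
bladeWeight {m} d e y = m * 4 + 5 + (bladeOffset e y + toℕ d * 8)

vertexWeight : ∀ m → WindmillVertex m × Fin 2 → ℕ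
vertexWeight m (hub , y)       = hubWeight m y
vertexWeight m (blade d e , y) = bladeWeight d e y

layerLabelSum : ∀ y → prismLabel 0 y + prismLabel 1 y ≡ 5
layerLabelSum zero       = refl
layerLabelSum (suc zero) = refl

cornerLabelSum : ∀ e y → prismLabel (toℕ (opposite e)) y + prismLabel 0 y + prismLabel (toℕ e) (opposite y) ≡
                         5 + bladeOffset e y
cornerLabelSum zero       zero       = refl
cornerLabelSum zero       (suc zero) = refl
cornerLabelSum (suc zero) zero       = refl
cornerLabelSum (suc zero) (suc zero) = refl

prismLabel-0-opposite : ∀ y → prismLabel 0 (opposite y) ≡ suc (toℕ y)
prismLabel-0-opposite zero       = refl
prismLabel-0-opposite (suc zero) = refl

module _ (m : ℕ) where

  private
    f : Fin (size (Prism m)) → Fin (size (Prism m))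
    f = swapEvenLayers (size (Windmill m))

  weight-hub : ∀ y → weight (Prism m) f (combine ⟦ hub {m} ⟧ y) ≡ hubWeight m y
  weight-hub y = begin
    weight (Prism m) f (combine ⟦ hub {m} ⟧ y)
      ≡⟨ weight≡neighbourSum (Prism m) f _ ⟩
    neighbourSum (Prism m) (label f) (combine ⟦ hub {m} ⟧ y)
      ≡⟨ neighbourSum-hub m (label f) y ⟩
    ∑[ d < m ] ∑[ e < 2 ] label f (combine ⟦ blade d e ⟧ y) + label f (combine ⟦ hub {m} ⟧ (opposite y))
      ≡⟨ cong₂ _+_ (sum-cong-≗ {m} (λ d → sum-cong-≗ {2} (λ e → label-⟦⟧ m (blade d e) y)))
                   (label-⟦⟧ m hub (opposite y)) ⟩
    ∑[ d < m ] ∑[ e < 2 ] vertexLabel (blade d e) y + vertexLabel (hub {m}) (opposite y)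
      ≡⟨ cong₂ _+_ (sum-cong-≗ {m} (λ d → bladeLayer (toℕ d) y)) (cong (m * 4 +_) (prismLabel-0-opposite y)) ⟩
    ∑[ d < m ] (toℕ d * 8 + 5) + (m * 4 + suc (toℕ y))
      ≡⟨ cong (_+ (m * 4 + suc (toℕ y))) (∑-8i+5 m) ⟩
    m * (m * 4 + 1) + (m * 4 + suc (toℕ y))
      ≡⟨ sym (+-assoc (m * (m * 4 + 1)) (m * 4) (suc (toℕ y))) ⟩
    hubWeight m y ∎
    where
    open ≡-Reasoning
    regroup : ∀ k a b → k * 4 + a + (k * 4 + b + 0) ≡ k * 8 + (a + b)
    regroup = solve-∀
    bladeLayer : ∀ k y → k * 4 + prismLabel 0 y + (k * 4 + prismLabel 1 y + 0) ≡ k * 8 + 5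
    bladeLayer k y = trans (regroup k _ _) (cong (k * 8 +_) (layerLabelSum y))

  weight-blade : ∀ d e y → weight (Prism m) f (combine ⟦ blade d e ⟧ y) ≡ bladeWeight d e y
  weight-blade d e y = begin
    weight (Prism m) f (combine ⟦ blade d e ⟧ y)
      ≡⟨ weight≡neighbourSum (Prism m) f _ ⟩
    neighbourSum (Prism m) (label f) (combine ⟦ blade d e ⟧ y)
      ≡⟨ neighbourSum-blade m (label f) d e y ⟩
    label f (combine ⟦ blade d (opposite e) ⟧ y) + label f (combine ⟦ hub {m} ⟧ y) +
    label f (combine ⟦ blade d e ⟧ (opposite y))
      ≡⟨ cong₂ _+_ (cong₂ _+_ (label-⟦⟧ m (blade d (opposite e)) y) (label-⟦⟧ m hub y))
                   (label-⟦⟧ m (blade d e) (opposite y)) ⟩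
    (k * 4 + prismLabel (toℕ (opposite e)) y) + (m * 4 + prismLabel 0 y) + (k * 4 + prismLabel (toℕ e) (opposite y))
      ≡⟨ regroup k m _ _ _ ⟩
    m * 4 + (prismLabel (toℕ (opposite e)) y + prismLabel 0 y + prismLabel (toℕ e) (opposite y)) + k * 8
      ≡⟨ cong (λ s → m * 4 + s + k * 8) (cornerLabelSum e y) ⟩
    m * 4 + (5 + bladeOffset e y) + k * 8
      ≡⟨ reassoc m (bladeOffset e y) k ⟩
    bladeWeight d e y ∎
    where
    open ≡-Reasoning
    k : ℕ
    k = toℕ d
    regroup : ∀ k m a b c → (k * 4 + a) + (m * 4 + b) + (k * 4 + c) ≡ m * 4 + (a + b + c) + k * 8
    regroup = solve-∀
    reassoc : ∀ m o k → m * 4 + (5 + o) + k * 8 ≡ m * 4 + 5 + (o + k * 8)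
    reassoc = solve-∀

  weight-prismVertex : ∀ a → weight (Prism m) f (prismVertex a) ≡ vertexWeight m a
  weight-prismVertex (hub , y)       = weight-hub y
  weight-prismVertex (blade d e , y) = weight-blade d e y

divMod-unique : ∀ k .{{_ : NonZero k}} {r r′ d d′} → r < k → r′ < k →
                r + d * k ≡ r′ + d′ * k → r ≡ r′ × d ≡ d′
divMod-unique k {r} {r′} {d} {d′} r<k r′<k eq =
  r≡r′ , *-cancelʳ-≡ d d′ k (+-cancelˡ-≡ r′ _ _ (subst (λ s → s + d * k ≡ r′ + d′ * k) r≡r′ eq))
  where
  open ≡-Reasoning
  r≡r′ : r ≡ r′
  r≡r′ = begin
    r                ≡⟨ m<n⇒m%n≡m r<k ⟨
    r % k            ≡⟨ [m+kn]%n≡m%n r d k ⟨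
    (r + d * k) % k   ≡⟨ cong (_% k) eq ⟩
    (r′ + d′ * k) % k ≡⟨ [m+kn]%n≡m%n r′ d′ k ⟩
    r′ % k           ≡⟨ m<n⇒m%n≡m r′<k ⟩
    r′               ∎

bladeWeight<hubWeight : ∀ {m} → 2 ≤ m → ∀ (d : Fin m) e y y′ → bladeWeight d e y < hubWeight m y′
bladeWeight<hubWeight {m} 2≤m d e y y′ = begin-strict
  m * 4 + 5 + (bladeOffset e y + toℕ d * 8) ≤⟨ +-monoʳ-≤ (m * 4 + 5) (+-monoˡ-≤ (toℕ d * 8) (bladeOffset≤3 e y)) ⟩
  m * 4 + 5 + (3 + toℕ d * 8)               ≡⟨ regroup m (toℕ d) ⟩
  m * 4 + suc (toℕ d) * 8                   ≤⟨ +-monoʳ-≤ (m * 4) (*-monoˡ-≤ 8 (toℕ<n d)) ⟩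
  m * 4 + m * 8                             ≤⟨ +-monoʳ-≤ (m * 4) (*-monoʳ-≤ m 8≤4m+1) ⟩
  m * 4 + m * (m * 4 + 1)                   ≡⟨ +-comm (m * 4) _ ⟩
  m * (m * 4 + 1) + m * 4                   <⟨ m<m+n _ z<s ⟩
  hubWeight m y′                            ∎
  where
  open ≤-Reasoning
  regroup : ∀ m k → m * 4 + 5 + (3 + k * 8) ≡ m * 4 + suc k * 8
  regroup = solve-∀
  8≤4m+1 : 8 ≤ m * 4 + 1
  8≤4m+1 = ≤-trans (*-monoˡ-≤ 4 2≤m) (m≤m+n (m * 4) 1)

vertexWeight-injective : ∀ m → 2 ≤ m → Injective _≡_ _≡_ (vertexWeight m)
vertexWeight-injective m _ {hub , y} {hub , y′} eq =
  cong (hub ,_) (toℕ-injective (suc-injective (+-cancelˡ-≡ (m * (m * 4 + 1) + m * 4) _ _ eq)))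
vertexWeight-injective m _ {blade d e , y} {blade d′ e′ , y′} eq
  with divMod-unique 8 (bladeOffset<8 e y) (bladeOffset<8 e′ y′) (+-cancelˡ-≡ (m * 4 + 5) _ _ eq)
... | same-offset , same-index
    with bladeOffset-injective same-offset | toℕ-injective {i = d} {j = d′} same-index
...   | refl | refl = refl
vertexWeight-injective m 2≤m {hub , y} {blade d e , y′} eq =
  contradiction (sym eq) (<⇒≢ (bladeWeight<hubWeight 2≤m d e y′ y))
vertexWeight-injective m 2≤m {blade d e , y} {hub , y′} eq =
  contradiction eq (<⇒≢ (bladeWeight<hubWeight 2≤m d e y y′))

isDAML-from-cover : ∀ G f {A : Set} (e : A → Fin (size G)) → StrictlySurjective _≡_ e →
                    (w : A → ℕ) → (∀ a → weight G f (e a) ≡ w a) → Injective _≡_ _≡_ w → IsDAML G f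
isDAML-from-cover G f e e-surjective w weight≡w w-injective u v eq
  with e-surjective u | e-surjective v
... | a , refl | b , refl = cong e (w-injective (trans (sym (weight≡w a)) (trans eq (weight≡w b))))

isDAML? : ∀ G f → Dec (IsDAML G f)
isDAML? G f = all? λ u → all? λ v → (weight G f u ℕ.≟ weight G f v) →-dec (u ≟ v)

permutation⇒HasDAML : ∀ G (π : Permutation′ (size G)) → IsDAML G (π ⟨$⟩ʳ_) → HasDAML G
permutation⇒HasDAML G π daml = π ⟨$⟩ʳ_ , Bijection.bijective (↔⇒⤖ π) , daml

prism-hasDAML : ∀ m → 2 ≤ m → HasDAML (Prism m)
prism-hasDAML m 2≤m =
  permutation⇒HasDAML (Prism m) (swapEvenLayers-permutation (size (Windmill m)))
    (isDAML-from-cover (Prism m) _ prismVertex (prismVertex-surjective m) (vertexWeight m) (weight-prismVertex m)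
                       (vertexWeight-injective m 2≤m))

theorem2p9 : (m : ℕ) → m ≥ 1 → HasDAML ((copies m (Γℤ 9) ⊹ Γℤ 4) □ Γℤ 9)
theorem2p9 1             _ = permutation⇒HasDAML (Prism 1) π (from-yes (isDAML? (Prism 1) (π ⟨$⟩ʳ_)))
  where π = transpose (# 3) (# 5)
theorem2p9 (suc (suc m)) _ = prism-hasDAML (suc (suc m)) (s≤s (s≤s z≤n))
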